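{- Fix a run-free standard s-partition $\pi$ of size $k$, let $\mathcal{F}$ be the set of standard s-partitions whose pruning yields $\pi$, and let $n>k$. Then a pair of sequences $(a_i)_{i=1}^r,(\ell_i)_{i=1}^r$ is the run-deletion sequence of some member of $\mathcal{F}$ of size $n$ if and only if: $r\ge1$; all $a_i$ and $\ell_i$ are positive integers; $k+\ell_1+\dots+\ell_r=n$; $a_1<a_2<\dots<a_r$; and $a_i\le k+\ell_1+\dots+\ell_{i-1}+1$ for every $i=1,\dots,r$.
   Context: A standard s-partition of size $n$ is a partition of $\{1,\dots,n\}$ into a set of lists (blocks). A run is a block consisting of consecutive integers in increasing order; an s-partition is run-free if it has no run. Deleting a run means removing that block and standardizing the remainder (relabeling entries order-preservingly by $1,2,\dots$). Pruning an s-partition means repeatedly deleting, as long as runs exist, the run with the largest first entry; this ends in a run-free s-partition (the result of pruning). Recording the deleted runs, listed in reverse order of deletion, as $(a_i)_{i=1}^r$ (the first entry of the run in the s-partition from which it was deleted) and $(\ell_i)_{i=1}^r$ (its length) gives the run-deletion sequence. -}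

module Defs where

open import Data.Nat using (ℕ; zero; suc; _+_; _∸_; _≤_; _<_; _<?_)
open import Data.List using (List; []; _∷_; _++_; [_]; map; concat; length; filter; applyUpTo)
open import Data.List.Relation.Unary.All using (All)
open import Data.List.Membership.Propositional using (_∈_)
open import Data.List.Relation.Binary.Permutation.Propositional using (_↭_)
open import Data.Product using (_×_; ∃; ∃-syntax)
open import Relation.Binary.PropositionalEquality using (_≡_)
open import Relation.Nullary using (¬_)
open import Data.Empty using (⊥)
open import Data.Unit using (⊤)

-- A block is a list of positive integers; an s-partition is a list of blocks,
-- read as a SET of blocks (block order is irrelevant; equality of
-- s-partitions is permutation of the block list, _↭_).
Block : Set
Block = List ℕ

SPart : Set
SPart = List Block

NonEmpty : Block → Set
NonEmpty []      = ⊥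
NonEmpty (_ ∷ _) = ⊤

range1 : ℕ → List ℕ
range1 n = applyUpTo suc n

IsStdSPartition : ℕ → SPart → Set
IsStdSPartition n p = All NonEmpty p × (concat p ↭ range1 n)

IsRunFrom : ℕ → ℕ → Block → Set
IsRunFrom a ℓ b = (1 ≤ ℓ) × (b ≡ applyUpTo (a +_) ℓ)

IsRun : Block → Set
IsRun b = ∃[ a ] ∃[ ℓ ] IsRunFrom a ℓ b

RunFree : SPart → Set
RunFree p = All (λ b → ¬ IsRun b) p

std : List ℕ → ℕ → ℕ
std removed x = x ∸ length (filter (_<? x) removed)

deleteStd : Block → SPart → SPart
deleteStd b rest = map (map (std b)) rest

-- Prune p q as ls : pruning p ends in q, with run-deletion sequence
-- (as, ls) (first entries and lengths, listed in REVERSE order of deletion).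
data Prune : SPart → SPart → List ℕ → List ℕ → Set where
  done : ∀ {p} → RunFree p → Prune p p [] []
  step : ∀ {p b rest q as ls} (a ℓ : ℕ) →
         p ↭ (b ∷ rest) →
         IsRunFrom a ℓ b →
         (∀ {c a′ ℓ′} → c ∈ rest → IsRunFrom a′ ℓ′ c → a′ < a) →
         Prune (deleteStd b rest) q as ls →
         Prune p q (as ++ [ a ]) (ls ++ [ ℓ ])

-- Deleting a run b = [a, …, a+ℓ-1] from a standard s-partition of size m leaves
-- the entries {1,…,a-1} ∪ {a+ℓ,…,m}, and standardizing them is inverse to the map
-- shiftFrom a ℓ, which fixes x < a and adds ℓ to x ≥ a.  Hence pruning one run is
-- undone by "opening a gap of length ℓ at a and inserting the run there", which is
-- possible exactly when 1 ≤ a ≤ m′ + 1 for the size m′ of the smaller s-partition.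
-- Shifting neither creates nor destroys runs starting at or after a, so the run
-- inserted at a is the one pruning deletes first precisely when all runs below it
-- start before a.  Induction on the number of deleted runs turns these facts into
-- the stated conditions, the size bound at step i being k + ℓ₁ + … + ℓᵢ₋₁.
module Submission where

open import Defs
open import Data.Nat using (ℕ; _+_; _≤_; _<_)
open import Data.Fin using (Fin; toℕ) renaming (_<_ to _<ᶠ_)
open import Data.Vec using (Vec; lookup; toList)
open import Data.List using (take)
open import Data.Nat.ListAction using (sum)
open import Relation.Binary.PropositionalEquality using (_≡_)
open import Data.Product using (_×_; ∃-syntax)
open import Data.List.Relation.Binary.Permutation.Propositional using (_↭_)
open import Function.Bundles using (_⇔_)

open import Data.Nat using (zero; suc; _∸_; _<?_; z≤n; s≤s; s≤s⁻¹; z<s)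
open import Data.Nat.Properties
open import Data.Nat.ListAction.Properties using (sum-++)
open import Data.Fin using () renaming (zero to fzero; suc to fsuc)
open import Data.Vec using ([]; _∷_)
open import Data.List using (List; []; _∷_; _++_; [_]; map; concat; length; applyUpTo; iterate)
open import Data.List.Properties
  using (map-++; map-∘; map-id; map-cong; map-id-local; map-cong-local; map-injective; concat-map;
         filter-all; filter-none; length-iterate; length-applyUpTo; ∷-injectiveˡ)
open import Data.List.Relation.Unary.All using (All; []; _∷_; universal)
import Data.List.Relation.Unary.All as All
open import Data.List.Relation.Unary.All.Properties using (++⁺; ++⁻ˡ; ++⁻ʳ; concat⁻)
import Data.List.Relation.Unary.All.Properties as AllP
import Data.Vec.Relation.Unary.All.Properties as VecAll
open import Data.List.Relation.Unary.Any using (here; there)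
open import Data.List.Membership.Propositional using (_∈_)
open import Data.List.Membership.Propositional.Properties using (∈-map⁺; ∈-map⁻; ∈-++⁺ˡ)
open import Data.List.Relation.Binary.Permutation.Propositional
  using (prep; swap; ↭-refl; ↭-sym; ↭-trans; ↭-reflexive; module PermutationReasoning)
import Data.List.Relation.Binary.Permutation.Propositional as Perm
open import Data.List.Relation.Binary.Permutation.Propositional.Properties
  using (++⁺ˡ; shifts; drop-mid; map⁺; ↭-length; ∈-resp-↭; All-resp-↭)
open import Data.Product using (_,_; proj₁; proj₂)
open import Data.Empty using (⊥-elim)
open import Data.Unit using (tt)
open import Function.Base using (_∘_)
open import Function.Definitions using (Injective)
open import Function.Bundles using (mk⇔)
open import Relation.Nullary using (yes; no)
open import Relation.Binary.PropositionalEquality using (refl; sym; trans; cong; cong₂; subst; module ≡-Reasoning)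

-- Intervals [s, s+1, …, s+n-1] are written iterate suc s n

applyUpTo-iterate : ∀ {f : ℕ → ℕ} s n → (∀ i → f i ≡ s + i) → applyUpTo f n ≡ iterate suc s n
applyUpTo-iterate s zero    f≗ = refl
applyUpTo-iterate s (suc n) f≗ =
  cong₂ _∷_ (trans (f≗ 0) (+-identityʳ s))
            (applyUpTo-iterate (suc s) n (λ i → trans (f≗ (suc i)) (+-suc s i)))

run≡iterate : ∀ a ℓ → applyUpTo (a +_) ℓ ≡ iterate suc a ℓ
run≡iterate a ℓ = applyUpTo-iterate a ℓ (λ _ → refl)

range1≡iterate : ∀ m → range1 m ≡ iterate suc 1 m
range1≡iterate = run≡iterate 1

iterate-++ : ∀ s m n → iterate suc s (m + n) ≡ iterate suc s m ++ iterate suc (s + m) n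
iterate-++ s zero    n = cong (λ t → iterate suc t n) (sym (+-identityʳ s))
iterate-++ s (suc m) n = cong (s ∷_) (trans (iterate-++ (suc s) m n)
  (cong (λ t → iterate suc (suc s) m ++ iterate suc t n) (sym (+-suc s m))))

∈-iterate⁻ : ∀ {x s n} → x ∈ iterate suc s n → s ≤ x × x < s + n
∈-iterate⁻ {s = s} {suc n} (here refl) = ≤-refl , m<m+n s z<s
∈-iterate⁻ {x} {s} {suc n} (there x∈) =
  let s<x , x<1+s+n = ∈-iterate⁻ x∈ in <⇒≤ s<x , subst (x <_) (sym (+-suc s n)) x<1+s+n

∈-iterate⁺ : ∀ s {n i} → i < n → s + i ∈ iterate suc s n
∈-iterate⁺ s {suc n} {zero}  _         = here (+-identityʳ s)
∈-iterate⁺ s {suc n} {suc i} (s≤s i<n) =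
  there (subst (_∈ iterate suc (suc s) n) (sym (+-suc s i)) (∈-iterate⁺ (suc s) i<n))

map-+-iterate : ∀ d s n → map (_+ d) (iterate suc s n) ≡ iterate suc (s + d) n
map-+-iterate d s zero    = refl
map-+-iterate d s (suc n) = cong (s + d ∷_) (map-+-iterate d (suc s) n)

-- Standardization against a run

std-below : ∀ b {x} → All (x ≤_) b → std b x ≡ x
std-below b {x} x≤b = cong (λ ys → x ∸ length ys) (filter-none (_<? x) (All.map ≤⇒≯ x≤b))

std-above : ∀ b {x} → All (_< x) b → std b x ≡ x ∸ length b
std-above b {x} b<x = cong (λ ys → x ∸ length ys) (filter-all (_<? x) b<x)

std-iterate-below : ∀ a ℓ {x} → x ≤ a → std (iterate suc a ℓ) x ≡ x
std-iterate-below a ℓ x≤a = std-below (iterate suc a ℓ) (All.tabulate (λ y∈ → ≤-trans x≤a (proj₁ (∈-iterate⁻ y∈))))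

std-iterate-above : ∀ a ℓ {x} → a + ℓ ≤ x → std (iterate suc a ℓ) x ≡ x ∸ ℓ
std-iterate-above a ℓ a+ℓ≤x =
  trans (std-above (iterate suc a ℓ) (All.tabulate (λ y∈ → <-≤-trans (proj₂ (∈-iterate⁻ y∈)) a+ℓ≤x)))
        (cong (_ ∸_) (length-iterate suc a ℓ))

shiftFrom : ℕ → ℕ → ℕ → ℕ
shiftFrom a ℓ x with x <? a
... | yes _ = x
... | no  _ = x + ℓ

shiftFrom-< : ∀ {a ℓ x} → x < a → shiftFrom a ℓ x ≡ x
shiftFrom-< {a} {ℓ} {x} x<a with x <? a
... | yes _   = refl
... | no  x≮a = ⊥-elim (x≮a x<a)

shiftFrom-≥ : ∀ {a ℓ x} → a ≤ x → shiftFrom a ℓ x ≡ x + ℓ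
shiftFrom-≥ {a} {ℓ} {x} a≤x with x <? a
... | yes x<a = ⊥-elim (<⇒≱ x<a a≤x)
... | no  _   = refl

shiftFrom-jump : ∀ a ℓ x → a ≤ shiftFrom a ℓ x → a + ℓ ≤ shiftFrom a ℓ x
shiftFrom-jump a ℓ x with x <? a
... | yes x<a = λ a≤x → ⊥-elim (<⇒≱ x<a a≤x)
... | no  x≮a = λ _ → +-monoˡ-≤ ℓ (≮⇒≥ x≮a)

std-shiftFrom : ∀ a ℓ x → std (iterate suc a ℓ) (shiftFrom a ℓ x) ≡ x
std-shiftFrom a ℓ x with x <? a
... | yes x<a = std-iterate-below a ℓ (<⇒≤ x<a)
... | no  x≮a = trans (std-iterate-above a ℓ (+-monoˡ-≤ ℓ (≮⇒≥ x≮a))) (m+n∸n≡m x ℓ)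

shiftFrom-injective : ∀ a ℓ → Injective _≡_ _≡_ (shiftFrom a ℓ)
shiftFrom-injective a ℓ {x} {y} eq =
  trans (sym (std-shiftFrom a ℓ x)) (trans (cong (std (iterate suc a ℓ)) eq) (std-shiftFrom a ℓ y))

shiftFrom-iterate-below : ∀ {a} ℓ s n → s + n ≤ a → map (shiftFrom a ℓ) (iterate suc s n) ≡ iterate suc s n
shiftFrom-iterate-below ℓ s n s+n≤a =
  map-id-local (All.tabulate (λ y∈ → shiftFrom-< (<-≤-trans (proj₂ (∈-iterate⁻ y∈)) s+n≤a)))

shiftFrom-iterate-above : ∀ {a} ℓ s n → a ≤ s → map (shiftFrom a ℓ) (iterate suc s n) ≡ iterate suc (s + ℓ) n
shiftFrom-iterate-above ℓ s n a≤s =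
  trans (map-cong-local (All.tabulate (λ y∈ → shiftFrom-≥ (≤-trans a≤s (proj₁ (∈-iterate⁻ y∈))))))
        (map-+-iterate ℓ s n)

iterate-run-split : ∀ {a m} ℓ → 1 ≤ a → a ≤ suc m →
  iterate suc a ℓ ++ map (shiftFrom a ℓ) (iterate suc 1 m) ↭ iterate suc 1 (m + ℓ)
iterate-run-split {suc a₀} {m} ℓ _ (s≤s a₀≤m) with m≤n⇒∃[o]m+o≡n a₀≤m
... | t , refl = begin
  run ++ map (shiftFrom a ℓ) (iterate suc 1 (a₀ + t)) ≡⟨ cong (run ++_) shifted ⟩
  run ++ below ++ above                                ↭⟨ shifts run below ⟩
  below ++ run ++ above                                ≡⟨ sym whole ⟩
  iterate suc 1 (a₀ + t + ℓ)                           ∎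
  where
  open PermutationReasoning
  a = suc a₀
  run = iterate suc a ℓ
  below = iterate suc 1 a₀
  above = iterate suc (a + ℓ) t
  shifted : map (shiftFrom a ℓ) (iterate suc 1 (a₀ + t)) ≡ below ++ above
  shifted = trans (cong (map (shiftFrom a ℓ)) (iterate-++ 1 a₀ t))
    (trans (map-++ (shiftFrom a ℓ) below (iterate suc a t))
           (cong₂ _++_ (shiftFrom-iterate-below ℓ 1 a₀ ≤-refl) (shiftFrom-iterate-above ℓ a t ≤-refl)))
  whole : iterate suc 1 (a₀ + t + ℓ) ≡ below ++ run ++ above
  whole = trans (cong (iterate suc 1) (trans (+-assoc a₀ t ℓ) (cong (a₀ +_) (+-comm t ℓ))))
    (trans (iterate-++ 1 a₀ (ℓ + t)) (cong (below ++_) (iterate-++ a ℓ t)))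

++-cancelˡ-↭ : ∀ {A : Set} (xs : List A) {ys zs : List A} → xs ++ ys ↭ xs ++ zs → ys ↭ zs
++-cancelˡ-↭ []       p = p
++-cancelˡ-↭ (x ∷ xs) p = ++-cancelˡ-↭ xs (drop-mid [] [] p)

run-complement : ∀ {a ℓ m R} → 1 ≤ ℓ → iterate suc a ℓ ++ R ↭ iterate suc 1 m →
  ∃[ m′ ] (m ≡ m′ + ℓ × 1 ≤ a × a ≤ suc m′ × R ↭ map (shiftFrom a ℓ) (iterate suc 1 m′))
run-complement {a} {suc l} {m} {R} _ perm =
  m ∸ ℓ , sym (m∸n+n≡m ℓ≤m) , 1≤a , a≤ , ++-cancelˡ-↭ run (↭-trans perm (↭-sym split))
  where
  ℓ = suc l
  run = iterate suc a ℓ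
  inInterval : ∀ {x} → x ∈ run → 1 ≤ x × x < suc m
  inInterval x∈ = ∈-iterate⁻ (∈-resp-↭ perm (∈-++⁺ˡ x∈))
  1≤a : 1 ≤ a
  1≤a = proj₁ (inInterval (here refl))
  a+ℓ≤1+m : a + ℓ ≤ suc m
  a+ℓ≤1+m = subst (_≤ suc m) (sym (+-suc a l)) (proj₂ (inInterval (∈-iterate⁺ a (n<1+n l))))
  ℓ≤m : ℓ ≤ m
  ℓ≤m = s≤s⁻¹ (≤-trans (+-monoˡ-≤ ℓ 1≤a) a+ℓ≤1+m)
  a≤ : a ≤ suc (m ∸ ℓ)
  a≤ = subst (a ≤_) (+-∸-assoc 1 ℓ≤m) (m+n≤o⇒m≤o∸n a a+ℓ≤1+m)
  split : run ++ map (shiftFrom a ℓ) (iterate suc 1 (m ∸ ℓ)) ↭ iterate suc 1 m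
  split = subst (λ n → run ++ map (shiftFrom a ℓ) (iterate suc 1 (m ∸ ℓ)) ↭ iterate suc 1 n)
                (m∸n+n≡m ℓ≤m) (iterate-run-split ℓ 1≤a a≤)

-- Standard s-partitions

concat-↭ : ∀ {A : Set} {xss yss : List (List A)} → xss ↭ yss → concat xss ↭ concat yss
concat-↭ Perm.refl        = ↭-refl
concat-↭ (prep xs p)      = ++⁺ˡ xs (concat-↭ p)
concat-↭ (swap xs ys p)   = ↭-trans (shifts xs ys) (++⁺ˡ ys (++⁺ˡ xs (concat-↭ p)))
concat-↭ (Perm.trans p q) = ↭-trans (concat-↭ p) (concat-↭ q)

map-map-∘ : ∀ {A B C : Set} (f : B → C) (g : A → B) (xss : List (List A)) → map (map f) (map (map g) xss) ≡ map (map (f ∘ g)) xss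
map-map-∘ f g xss = trans (sym (map-∘ xss)) (map-cong (λ xs → sym (map-∘ xs)) xss)

map-map-id-local : ∀ {A : Set} {f : A → A} {xss : List (List A)} → All (λ x → f x ≡ x) (concat xss) → map (map f) xss ≡ xss
map-map-id-local fx≡x = map-id-local (All.map map-id-local (concat⁻ fx≡x))

NonEmpty-map : ∀ (f : ℕ → ℕ) {xss : SPart} → All NonEmpty xss → All NonEmpty (map (map f) xss)
NonEmpty-map f []                         = []
NonEmpty-map f {(_ ∷ _) ∷ _} (_ ∷ nonEmpty) = tt ∷ NonEmpty-map f nonEmpty

std-size-unique : ∀ {m k p q} → IsStdSPartition m p → IsStdSPartition k q → p ↭ q → m ≡ k
std-size-unique {m} {k} {p} {q} (_ , concat-p) (_ , concat-q) p↭q = begin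
  m                      ≡⟨ sym (length-applyUpTo suc m) ⟩
  length (range1 m)      ≡⟨ sym (↭-length concat-p) ⟩
  length (concat p)      ≡⟨ ↭-length (concat-↭ p↭q) ⟩
  length (concat q)      ≡⟨ ↭-length concat-q ⟩
  length (range1 k)      ≡⟨ length-applyUpTo suc k ⟩
  k                      ∎
  where open ≡-Reasoning

insertRun : ℕ → ℕ → SPart → SPart
insertRun a ℓ σ = iterate suc a ℓ ∷ map (map (shiftFrom a ℓ)) σ

insertRun-isStd : ∀ {m σ a ℓ} → IsStdSPartition m σ → 1 ≤ a → a ≤ suc m → 1 ≤ ℓ →
  IsStdSPartition (m + ℓ) (insertRun a ℓ σ)
insertRun-isStd {m} {σ} {a} {suc l} (nonEmpty , concat-σ) 1≤a a≤ _ =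
  tt ∷ NonEmpty-map (shiftFrom a ℓ) nonEmpty , (begin
    iterate suc a ℓ ++ concat (map (map (shiftFrom a ℓ)) σ) ≡⟨ cong (iterate suc a ℓ ++_) (concat-map σ) ⟩
    iterate suc a ℓ ++ map (shiftFrom a ℓ) (concat σ)      ↭⟨ ++⁺ˡ (iterate suc a ℓ) (map⁺ _ concat-σ) ⟩
    iterate suc a ℓ ++ map (shiftFrom a ℓ) (range1 m)
      ≡⟨ cong (λ xs → iterate suc a ℓ ++ map (shiftFrom a ℓ) xs) (range1≡iterate m) ⟩
    iterate suc a ℓ ++ map (shiftFrom a ℓ) (iterate suc 1 m) ↭⟨ iterate-run-split ℓ 1≤a a≤ ⟩
    iterate suc 1 (m + ℓ)                                  ≡⟨ sym (range1≡iterate (m + ℓ)) ⟩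
    range1 (m + ℓ)                                         ∎)
  where
  open PermutationReasoning
  ℓ = suc l

deleteStd-insertRun : ∀ a ℓ σ → deleteStd (iterate suc a ℓ) (map (map (shiftFrom a ℓ)) σ) ≡ σ
deleteStd-insertRun a ℓ σ =
  trans (map-map-∘ _ _ σ) (map-map-id-local (universal (std-shiftFrom a ℓ) (concat σ)))

deleteRun : ∀ {m p b rest a ℓ} → IsStdSPartition m p → p ↭ b ∷ rest → IsRunFrom a ℓ b →
  ∃[ m′ ] (m ≡ m′ + ℓ × 1 ≤ a × a ≤ suc m′ × IsStdSPartition m′ (deleteStd b rest)
           × map (map (shiftFrom a ℓ)) (deleteStd b rest) ≡ rest)
deleteRun {m} {_} {_} {rest} {a} {ℓ} (nonEmpty , concat-p) perm (1≤ℓ , refl)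
  with run-complement 1≤ℓ (subst (λ c → c ++ concat rest ↭ iterate suc 1 m) (run≡iterate a ℓ)
         (↭-trans (concat-↭ (↭-sym perm)) (↭-trans concat-p (↭-reflexive (range1≡iterate m)))))
... | m′ , m≡ , 1≤a , a≤ , rest↭ = m′ , m≡ , 1≤a , a≤ , (nonEmpty′ , concat-deleted) , reinsert
  where
  b = applyUpTo (a +_) ℓ
  std-shift : ∀ y → std b (shiftFrom a ℓ y) ≡ y
  std-shift y = trans (cong (λ c → std c (shiftFrom a ℓ y)) (run≡iterate a ℓ)) (std-shiftFrom a ℓ y)
  nonEmpty′ : All NonEmpty (deleteStd b rest)
  nonEmpty′ with All-resp-↭ perm nonEmpty
  ... | _ ∷ nonEmpty-rest = NonEmpty-map (std b) nonEmpty-rest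
  concat-deleted : concat (deleteStd b rest) ↭ range1 m′
  concat-deleted = begin
    concat (deleteStd b rest)                       ≡⟨ concat-map rest ⟩
    map (std b) (concat rest)                       ↭⟨ map⁺ (std b) rest↭ ⟩
    map (std b) (map (shiftFrom a ℓ) (iterate suc 1 m′))
      ≡⟨ trans (sym (map-∘ _)) (trans (map-cong std-shift _) (map-id _)) ⟩
    iterate suc 1 m′                                ≡⟨ sym (range1≡iterate m′) ⟩
    range1 m′                                       ∎
    where open PermutationReasoning
  reinsert : map (map (shiftFrom a ℓ)) (deleteStd b rest) ≡ rest
  reinsert = trans (map-map-∘ _ _ rest) (map-map-id-local (All-resp-↭ (↭-sym rest↭)
    (AllP.map⁺ (universal (λ y → cong (shiftFrom a ℓ) (std-shift y)) _))))

-- Runs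

RunsBelow : ℕ → SPart → Set
RunsBelow B p = ∀ {c a ℓ} → c ∈ p → IsRunFrom a ℓ c → a < B

IsRunFrom-start-unique : ∀ {a a′ ℓ ℓ′ c} → IsRunFrom a ℓ c → IsRunFrom a′ ℓ′ c → a ≡ a′
IsRunFrom-start-unique {a} {a′} {suc _} {suc _} (_ , refl) (_ , c≡) =
  +-cancelʳ-≡ 0 a a′ (∷-injectiveˡ c≡)

shiftFrom-run⁺ : ∀ {a ℓ a′ ℓ′ c} → a ≤ a′ → IsRunFrom a′ ℓ′ c →
  IsRunFrom (a′ + ℓ) ℓ′ (map (shiftFrom a ℓ) c)
shiftFrom-run⁺ {a} {ℓ} {a′} {ℓ′} a≤a′ (1≤ℓ′ , refl) = 1≤ℓ′ , (begin
  map (shiftFrom a ℓ) (applyUpTo (a′ +_) ℓ′)  ≡⟨ cong (map _) (run≡iterate a′ ℓ′) ⟩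
  map (shiftFrom a ℓ) (iterate suc a′ ℓ′)     ≡⟨ shiftFrom-iterate-above ℓ a′ ℓ′ a≤a′ ⟩
  iterate suc (a′ + ℓ) ℓ′                     ≡⟨ sym (run≡iterate (a′ + ℓ) ℓ′) ⟩
  applyUpTo (a′ + ℓ +_) ℓ′                    ∎)
  where open ≡-Reasoning

shiftFrom-run⁻ : ∀ {a ℓ a′ ℓ′ c} → a ≤ a′ → IsRunFrom a′ ℓ′ (map (shiftFrom a ℓ) c) →
  a ≤ a′ ∸ ℓ × IsRunFrom (a′ ∸ ℓ) ℓ′ c
shiftFrom-run⁻ {a} {ℓ} {a′} {suc l′} {x ∷ xs} a≤a′ (1≤ℓ′ , fc≡) =
  a≤a′∸ℓ , 1≤ℓ′ , map-injective (shiftFrom-injective a ℓ) (begin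
    map (shiftFrom a ℓ) (x ∷ xs)                  ≡⟨ fc≡ ⟩
    applyUpTo (a′ +_) (suc l′)                    ≡⟨ cong (λ t → applyUpTo (t +_) (suc l′)) (sym (m∸n+n≡m ℓ≤a′)) ⟩
    applyUpTo (a′ ∸ ℓ + ℓ +_) (suc l′)            ≡⟨ proj₂ (shiftFrom-run⁺ a≤a′∸ℓ (1≤ℓ′ , refl)) ⟨
    map (shiftFrom a ℓ) (applyUpTo (a′ ∸ ℓ +_) (suc l′)) ∎)
  where
  open ≡-Reasoning
  a′≡ : shiftFrom a ℓ x ≡ a′
  a′≡ = trans (∷-injectiveˡ fc≡) (+-identityʳ a′)
  a+ℓ≤a′ : a + ℓ ≤ a′
  a+ℓ≤a′ = subst (a + ℓ ≤_) a′≡ (shiftFrom-jump a ℓ x (subst (a ≤_) (sym a′≡) a≤a′))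
  ℓ≤a′ : ℓ ≤ a′
  ℓ≤a′ = ≤-trans (m≤n+m ℓ a) a+ℓ≤a′
  a≤a′∸ℓ : a ≤ a′ ∸ ℓ
  a≤a′∸ℓ = m+n≤o⇒m≤o∸n a a+ℓ≤a′

RunsBelow-shiftFrom⁺ : ∀ {a ℓ σ} → RunsBelow a σ → RunsBelow a (map (map (shiftFrom a ℓ)) σ)
RunsBelow-shiftFrom⁺ {a} {ℓ} below c∈ run with ∈-map⁻ (map (shiftFrom a ℓ)) c∈
... | c₀ , c₀∈ , refl = ≰⇒> λ a≤a′ →
  let a≤a′∸ℓ , run₀ = shiftFrom-run⁻ a≤a′ run in <⇒≱ (below c₀∈ run₀) a≤a′∸ℓ

RunsBelow-shiftFrom⁻ : ∀ {a ℓ σ} → RunsBelow a (map (map (shiftFrom a ℓ)) σ) → RunsBelow a σ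
RunsBelow-shiftFrom⁻ {a} {ℓ} below {a = a′} c∈ run = ≰⇒> λ a≤a′ →
  <⇒≱ (below (∈-map⁺ (map (shiftFrom a ℓ)) c∈) (shiftFrom-run⁺ a≤a′ run)) (≤-trans a≤a′ (m≤m+n a′ ℓ))

deleteRun-runsBelow : ∀ {m p b rest a ℓ} → IsStdSPartition m p → p ↭ b ∷ rest → IsRunFrom a ℓ b →
  RunsBelow a rest → RunsBelow a (deleteStd b rest)
deleteRun-runsBelow {a = a} stdp perm run below with deleteRun stdp perm run
... | _ , _ , _ , _ , _ , reinsert = RunsBelow-shiftFrom⁻ (subst (RunsBelow a) (sym reinsert) below)

-- Pruning

prune-runsBelow : ∀ {B σ q as ls} → Prune σ q as ls → All (_< B) as → RunsBelow B σ
prune-runsBelow (done runFree) _ c∈ run = ⊥-elim (All.lookup runFree c∈ (_ , _ , run))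
prune-runsBelow {B} (step {as = as} a ℓ perm run largest _) as<B c∈ run′
  with ++⁻ʳ as as<B | ∈-resp-↭ perm c∈
... | a<B ∷ [] | here refl = subst (_< B) (IsRunFrom-start-unique run run′) a<B
... | a<B ∷ [] | there c∈rest = <-trans (largest c∈rest run′) a<B

prune-firstEntries-below : ∀ {B m p q as ls} → IsStdSPartition m p → Prune p q as ls →
  RunsBelow B p → All (_< B) as
prune-firstEntries-below _ (done _) _ = []
prune-firstEntries-below {B} stdp (step a ℓ perm run largest pr) below
  with deleteRun stdp perm run
... | _ , _ , _ , _ , stdp′ , _ =
  ++⁺ (All.map (λ x<a → <-trans x<a a<B)
              (prune-firstEntries-below stdp′ pr (deleteRun-runsBelow stdp perm run largest)))
      (a<B ∷ [])
  where
  a<B : a < B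
  a<B = below (∈-resp-↭ (↭-sym perm) (here refl)) run

-- Admissible run-deletion sequences, grown at the end (the order in which pruning
-- peels them off) and at the front (the order in which the statement reads them)

data Admissibleʳ (k : ℕ) : List ℕ → List ℕ → ℕ → Set where
  []   : Admissibleʳ k [] [] k
  snoc : ∀ {as ls m a ℓ} → Admissibleʳ k as ls m → All (_< a) as → 1 ≤ a → a ≤ suc m → 1 ≤ ℓ →
         Admissibleʳ k (as ++ [ a ]) (ls ++ [ ℓ ]) (m + ℓ)

data Admissible : ℕ → List ℕ → List ℕ → Set where
  []   : ∀ {m} → Admissible m [] []
  cons : ∀ {m a ℓ as ls} → 1 ≤ a → 1 ≤ ℓ → a ≤ suc m → All (a <_) as → Admissible (m + ℓ) as ls →
         Admissible m (a ∷ as) (ℓ ∷ ls)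

prune⇒admissibleʳ : ∀ {k π m p q as ls} → IsStdSPartition k π → IsStdSPartition m p →
  Prune p q as ls → q ↭ π → Admissibleʳ k as ls m
prune⇒admissibleʳ stdπ stdp (done _) q↭π =
  subst (Admissibleʳ _ [] []) (std-size-unique stdπ stdp (↭-sym q↭π)) []
prune⇒admissibleʳ {k} stdπ stdp (step {as = as} {ls} a ℓ perm run largest pr) q↭π
  with deleteRun stdp perm run
... | _ , m≡ , 1≤a , a≤ , stdp′ , _ =
  subst (Admissibleʳ k (as ++ [ a ]) (ls ++ [ ℓ ])) (sym m≡)
    (snoc (prune⇒admissibleʳ stdπ stdp′ pr q↭π)
          (prune-firstEntries-below stdp′ pr (deleteRun-runsBelow stdp perm run largest))
          1≤a a≤ (proj₁ run))

admissibleʳ⇒prune : ∀ {k π as ls m} → IsStdSPartition k π → RunFree π → Admissibleʳ k as ls m →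
  ∃[ σ ] (IsStdSPartition m σ × Prune σ π as ls)
admissibleʳ⇒prune stdπ runFree [] = _ , stdπ , done runFree
admissibleʳ⇒prune {π = π} stdπ runFree (snoc {as} {ls} {a = a} {ℓ} adm as<a 1≤a a≤ 1≤ℓ)
  with admissibleʳ⇒prune stdπ runFree adm
... | σ , stdσ , pr =
  insertRun a ℓ σ , insertRun-isStd stdσ 1≤a a≤ 1≤ℓ ,
  step a ℓ ↭-refl (1≤ℓ , sym (run≡iterate a ℓ)) (RunsBelow-shiftFrom⁺ (prune-runsBelow pr as<a))
       (subst (λ p → Prune p π as ls) (sym (deleteStd-insertRun a ℓ σ)) pr)

admissible-snoc : ∀ {m as ls a ℓ} → Admissible m as ls → All (_< a) as → 1 ≤ a → a ≤ suc (m + sum ls) → 1 ≤ ℓ →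
  Admissible m (as ++ [ a ]) (ls ++ [ ℓ ])
admissible-snoc {m} {a = a} [] _ 1≤a a≤ 1≤ℓ = cons 1≤a 1≤ℓ (subst (λ t → a ≤ suc t) (+-identityʳ m) a≤) [] []
admissible-snoc {m} {a = a} (cons {ℓ = ℓ′} {ls = ls} 1≤a′ 1≤ℓ′ a′≤ a′<as adm) (a′<a ∷ as<a) 1≤a a≤ 1≤ℓ =
  cons 1≤a′ 1≤ℓ′ a′≤ (++⁺ a′<as (a′<a ∷ []))
       (admissible-snoc adm as<a 1≤a (subst (λ t → a ≤ suc t) (sym (+-assoc m ℓ′ (sum ls))) a≤) 1≤ℓ)

admissibleʳ⇒admissible : ∀ {k as ls m} → Admissibleʳ k as ls m → Admissible k as ls × m ≡ k + sum ls
admissibleʳ⇒admissible {k} [] = [] , sym (+-identityʳ k)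
admissibleʳ⇒admissible {k} (snoc {ls = ls} {ℓ = ℓ} adm as<a 1≤a a≤ 1≤ℓ)
  with admissibleʳ⇒admissible adm
... | adm′ , refl = admissible-snoc adm′ as<a 1≤a a≤ 1≤ℓ , (begin
  k + sum ls + ℓ          ≡⟨ +-assoc k (sum ls) ℓ ⟩
  k + (sum ls + ℓ)        ≡⟨ cong (λ t → k + (sum ls + t)) (+-identityʳ ℓ) ⟨
  k + (sum ls + sum [ ℓ ]) ≡⟨ cong (k +_) (sum-++ ls [ ℓ ]) ⟨
  k + sum (ls ++ [ ℓ ])   ∎)
  where open ≡-Reasoning

admissibleʳ-cons : ∀ {k ℓ as ls m a} → Admissibleʳ (k + ℓ) as ls m → 1 ≤ a → 1 ≤ ℓ → a ≤ suc k →
  All (a <_) as → Admissibleʳ k (a ∷ as) (ℓ ∷ ls) m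
admissibleʳ-cons [] 1≤a 1≤ℓ a≤ _ = snoc [] [] 1≤a a≤ 1≤ℓ
admissibleʳ-cons (snoc {as = as} adm as<a′ 1≤a′ a′≤ 1≤ℓ′) 1≤a 1≤ℓ a≤ a<as =
  snoc (admissibleʳ-cons adm 1≤a 1≤ℓ a≤ (++⁻ˡ as a<as)) (head (++⁻ʳ as a<as) ∷ as<a′) 1≤a′ a′≤ 1≤ℓ′
  where
  head : ∀ {a x} → All (a <_) [ x ] → a < x
  head (a<x ∷ []) = a<x

admissible⇒admissibleʳ : ∀ {k as ls} → Admissible k as ls → Admissibleʳ k as ls (k + sum ls)
admissible⇒admissibleʳ {k} [] = subst (Admissibleʳ k [] []) (sym (+-identityʳ k)) []
admissible⇒admissibleʳ {k} (cons {ℓ = ℓ} {ls = ls} 1≤a 1≤ℓ a≤ a<as adm) =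
  subst (Admissibleʳ k _ _) (+-assoc k ℓ (sum ls))
        (admissibleʳ-cons (admissible⇒admissibleʳ adm) 1≤a 1≤ℓ a≤ a<as)

AdmissibleVec : ∀ {r} → ℕ → Vec ℕ r → Vec ℕ r → Set
AdmissibleVec m as ls =
  (∀ i → 1 ≤ lookup as i) × (∀ i → 1 ≤ lookup ls i) × (∀ i j → i <ᶠ j → lookup as i < lookup as j)
  × (∀ i → lookup as i ≤ m + sum (take (toℕ i) (toList ls)) + 1)

suc≡+0+1 : ∀ m → suc m ≡ m + 0 + 1
suc≡+0+1 m = trans (+-comm 1 m) (cong (_+ 1) (sym (+-identityʳ m)))

admissible⇒admissibleVec : ∀ {r} m (as ls : Vec ℕ r) → Admissible m (toList as) (toList ls) → AdmissibleVec m as ls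
admissible⇒admissibleVec m [] [] [] = (λ ()) , (λ ()) , (λ ()) , (λ ())
admissible⇒admissibleVec m (a ∷ as) (ℓ ∷ ls) (cons 1≤a 1≤ℓ a≤ a<as adm)
  with admissible⇒admissibleVec (m + ℓ) as ls adm
... | 1≤as , 1≤ls , increasing , bounded = positive-as , positive-ls , increasing′ , bounded′
  where
  positive-as : ∀ i → 1 ≤ lookup (a ∷ as) i
  positive-as fzero    = 1≤a
  positive-as (fsuc i) = 1≤as i
  positive-ls : ∀ i → 1 ≤ lookup (ℓ ∷ ls) i
  positive-ls fzero    = 1≤ℓ
  positive-ls (fsuc i) = 1≤ls i
  increasing′ : ∀ i j → i <ᶠ j → lookup (a ∷ as) i < lookup (a ∷ as) j
  increasing′ fzero    (fsuc j) _         = VecAll.lookup⁺ (VecAll.toList⁻ a<as) j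
  increasing′ (fsuc i) (fsuc j) (s≤s i<j) = increasing i j i<j
  bounded′ : ∀ i → lookup (a ∷ as) i ≤ m + sum (take (toℕ i) (toList (ℓ ∷ ls))) + 1
  bounded′ fzero    = subst (a ≤_) (suc≡+0+1 m) a≤
  bounded′ (fsuc i) = subst (λ t → lookup as i ≤ t + 1) (+-assoc m ℓ _) (bounded i)

admissibleVec⇒admissible : ∀ {r} m (as ls : Vec ℕ r) → AdmissibleVec m as ls → Admissible m (toList as) (toList ls)
admissibleVec⇒admissible m [] [] _ = []
admissibleVec⇒admissible m (a ∷ as) (ℓ ∷ ls) (1≤as , 1≤ls , increasing , bounded) =
  cons (1≤as fzero) (1≤ls fzero) (subst (a ≤_) (sym (suc≡+0+1 m)) (bounded fzero))
       (VecAll.toList⁺ (VecAll.lookup⁻ (λ j → increasing fzero (fsuc j) (s≤s z≤n))))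
       (admissibleVec⇒admissible (m + ℓ) as ls
         ( (λ i → 1≤as (fsuc i)) , (λ i → 1≤ls (fsuc i)) , (λ i j i<j → increasing (fsuc i) (fsuc j) (s≤s i<j))
         , (λ i → subst (λ t → lookup as i ≤ t + 1) (sym (+-assoc m ℓ _)) (bounded (fsuc i)))))

nonempty-of-growth : ∀ {k n r} → k < n → (ls : Vec ℕ r) → k + sum (toList ls) ≡ n → 1 ≤ r
nonempty-of-growth {k} k<n []      k≡n = ⊥-elim (<-irrefl (trans (sym (+-identityʳ k)) k≡n) k<n)
nonempty-of-growth _   (_ ∷ _) _ = s≤s z≤n

proposition11 : (k : ℕ) (π : SPart) → IsStdSPartition k π → RunFree π →
    (n : ℕ) → k < n → (r : ℕ) (as ls : Vec ℕ r) →
    (∃[ σ ] ∃[ q ] (IsStdSPartition n σ × Prune σ q (toList as) (toList ls) × q ↭ π))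
    ⇔
    ((1 ≤ r)
     × (∀ i → 1 ≤ lookup as i)
     × (∀ i → 1 ≤ lookup ls i)
     × (k + sum (toList ls) ≡ n)
     × (∀ i j → i <ᶠ j → lookup as i < lookup as j)
     × (∀ i → lookup as i ≤ k + sum (take (toℕ i) (toList ls)) + 1))
proposition11 k π stdπ runFree n k<n r as ls = mk⇔
  (λ (σ , q , stdσ , pr , q↭π) →
    let adm , n≡ = admissibleʳ⇒admissible (prune⇒admissibleʳ stdπ stdσ pr q↭π)
        1≤as , 1≤ls , increasing , bounded = admissible⇒admissibleVec k as ls adm
    in nonempty-of-growth k<n ls (sym n≡) , 1≤as , 1≤ls , sym n≡ , increasing , bounded)
  (λ (_ , 1≤as , 1≤ls , k+∑ℓ≡n , increasing , bounded) →
    let adm = admissibleVec⇒admissible k as ls (1≤as , 1≤ls , increasing , bounded)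
        σ , stdσ , pr = admissibleʳ⇒prune stdπ runFree (admissible⇒admissibleʳ adm)
    in σ , π , subst (λ t → IsStdSPartition t σ) k+∑ℓ≡n stdσ , pr , ↭-refl)
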